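{- Let $V$ be a finite set of nodes with metric edge weights $c$ (i.e., the complete graph on $V$ with nonnegative weights satisfying the triangle inequality). Let $T$ be a minimum spanning tree on $V$, let $V_b \cup V_r = V$ be any 2-coloring of $V$ (a partition of $V$ into blue and red nodes, with no further constraint), and let $T_b$ and $T_r$ be minimum spanning trees of $V_b$ and $V_r$, respectively. Then (a) $c(T_b)+c(T_r) \le 3\,c(T)$, and (b) $\max\{c(T_b),c(T_r)\} \le 2\,c(T)$.
   Context: For a set of edges $F$, $c(F)$ denotes the total weight of its edges. A minimum spanning tree of a node subset $U\subseteq V$ is a minimum-weight spanning tree of the complete graph induced on $U$.
   Formalization: The metric edge weights $c$ take values in the rationals. -}

module Defs where

open import Data.Nat using (ℕ; _≤_)
open import Data.Fin using (Fin; toℕ)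
open import Data.Fin.Subset using (Subset; _∈_)
open import Data.Integer using (+_)
open import Data.Rational using (ℚ; 0ℚ; _+_; _*_; _/_) renaming (_≤_ to _≤ℚ_; _<_ to _<ℚ_)
open import Data.List using (List; []; _∷_; map; sum; foldr; length; _++_; [_])
open import Data.List.Membership.Propositional using () renaming (_∈_ to _∈ₗ_)
open import Data.List.Relation.Unary.Unique.Propositional using (Unique)
open import Data.List.Relation.Unary.Linked using (Linked)
open import Data.Product using (_×_; _,_; proj₁; proj₂; Σ; ∃)
open import Data.Sum using (_⊎_)
open import Data.Nat using (_<_)
open import Relation.Binary.PropositionalEquality using (_≡_)
open import Relation.Nullary using (¬_)
open import Data.Empty using (⊥)

record Metric {n : ℕ} (c : Fin n → Fin n → ℚ) : Set where
  field
    diag-zero : ∀ u → c u u ≡ 0ℚ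
    nonneg    : ∀ u v → 0ℚ ≤ℚ c u v
    symm      : ∀ u v → c u v ≡ c v u
    triangle  : ∀ u v w → c u w ≤ℚ (c u v + c v w)

-- An undirected edge {u,v} of the complete graph is represented canonically
-- as the ordered pair (u , v) with u < v; an edge set is a duplicate-free list.
Edge : ℕ → Set
Edge n = Fin n × Fin n

weight : ∀ {n} → (Fin n → Fin n → ℚ) → List (Edge n) → ℚ
weight c F = foldr (λ e acc → c (proj₁ e) (proj₂ e) + acc) 0ℚ F

Adj : ∀ {n} → List (Edge n) → Fin n → Fin n → Set
Adj F u v = ((u , v) ∈ₗ F) ⊎ ((v , u) ∈ₗ F)

data Walk {n : ℕ} (F : List (Edge n)) : Fin n → Fin n → Set where
  here : ∀ {u} → Walk F u u
  step : ∀ {u v w} → Adj F u v → Walk F v w → Walk F u w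

Connected : ∀ {n} → Subset n → List (Edge n) → Set
Connected U F = ∀ u v → u ∈ U → v ∈ U → Walk F u v

Cycle : ∀ {n} → List (Edge n) → List (Fin n) → Set
Cycle F [] = ⊥
Cycle F (v ∷ ws) = (3 ≤ length (v ∷ ws)) × Unique (v ∷ ws) × Linked (Adj F) (v ∷ ws ++ [ v ])

Acyclic : ∀ {n} → List (Edge n) → Set
Acyclic F = ∀ vs → ¬ Cycle F vs

record IsSpanningTree {n : ℕ} (U : Subset n) (F : List (Edge n)) : Set where
  field
    canonical : ∀ {e} → e ∈ₗ F → toℕ (proj₁ e) < toℕ (proj₂ e)
    inside    : ∀ {e} → e ∈ₗ F → (proj₁ e ∈ U) × (proj₂ e ∈ U)
    distinct  : Unique F
    connected : Connected U F
    acyclic   : Acyclic F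

record IsMST {n : ℕ} (c : Fin n → Fin n → ℚ) (U : Subset n) (F : List (Edge n)) : Set where
  field
    tree    : IsSpanningTree U F
    minimal : ∀ F' → IsSpanningTree U F' → weight c F ≤ℚ weight c F'

{-# OPTIONS --safe #-}
-- Hang T from a root and read it as a tree of joins, each attaching a subtree by one edge vs.
-- For a colour class P charge that edge c(v,s) if v ∈ P and 2c(v,s) otherwise: the blue and
-- red charges of an edge add up to 3c(v,s), and each is at most 2c(v,s).  By induction over
-- the joins, the P-vertices below v carry a tree rooted at a P-vertex y whose cost plus the
-- slack 2c(v,y) stays within the charge.  Two such trees with roots y₁, y₂ are merged by the
-- edge y₁y₂, paid for through c(y₁,y₂) ≤ c(v,y₁) + c(v,y₂) and the slacks, keeping the root
-- nearer to v.  An MST weighs no more than any such tree on its vertex set, so c(T_b) and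
-- c(T_r) are bounded by their charges.
module Submission where

open import Defs
open import Data.Nat using (ℕ)
open import Data.Fin using (Fin)
open import Data.Fin.Subset using (Subset; ⊤; ∁)
open import Data.Integer using (+_)
open import Data.Rational using (ℚ; _+_; _*_; _/_; _≤_; _⊔_)
open import Data.List using (List)
open import Data.Product using (_×_)

open import Data.Nat using (zero; suc; s≤s) renaming (_≤_ to _≤ₙ_; _<_ to _<ₙ_)
import Data.Nat.Properties as ℕₚ
open import Data.Fin using (_≟_; toℕ) renaming (zero to fzero)
open import Data.Fin.Properties using (<-cmp)
open import Data.Fin.Subset using (_∈_; _∉_; _⊆_; _∪_; ⁅_⁆)
open import Data.Fin.Subset.Properties using (_∈?_; ∈⊤; ⊆-refl; x∈p⇒x∉∁p; x∉p⇒x∈∁p)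
open import Data.Fin.Subset.Properties using (x∈⁅x⁆; x∈⁅y⁆⇒x≡y; x∈p∪q⁺; x∈p∪q⁻; q⊆p∪q)
open import Data.Rational using (0ℚ)
open import Data.Rational.Properties using (≤-refl; ≤-reflexive; ≤-trans; _≤?_; ≰⇒>; <⇒≤; ⊔-lub)
open import Data.Rational.Properties using (+-mono-≤; +-monoˡ-≤; +-monoʳ-≤; +-identityˡ; +-identityʳ; +-comm)
open import Data.Rational.Properties using (module ≤-Reasoning)
open import Data.Rational.Solver using (module +-*-Solver)
open import Data.List using ([]; _∷_; _++_; [_]; _∷ʳ_; length; initLast; _∷ʳ′_)
open import Data.List.Properties using (++-assoc; ++-identityʳ; length-++-comm)
open import Data.List.Membership.Propositional using (find; lose) renaming (_∈_ to _∈ₗ_)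
open import Data.List.Membership.Propositional.Properties using (∈-∃++; ∈-++⁻)
import Data.List.Membership.DecPropositional as DecMembership
open import Data.List.Relation.Unary.Any using (here; there; any?)
open import Data.List.Relation.Unary.All as All using (All; []; _∷_)
import Data.List.Relation.Unary.All.Properties as All
open import Data.List.Relation.Unary.AllPairs using ([]; _∷_)
open import Data.List.Relation.Unary.Unique.Propositional using (Unique)
open import Data.List.Relation.Unary.Linked using (Linked; []; [-]; _∷_)
open import Data.List.Relation.Binary.Permutation.Propositional as ↭ using (_↭_; ↭-sym)
open import Data.List.Relation.Binary.Permutation.Propositional.Properties using (shift; ∈-resp-↭; ↭-length)
open import Data.Product using (_,_; proj₁; proj₂; ∃; ∃₂; Σ) renaming (map to map×; swap to swap×)
open import Data.Sum using (_⊎_; inj₁; inj₂; [_,_])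
open import Data.Empty using (⊥-elim)
open import Function using (_∘_)
open import Relation.Nullary using (¬_; Dec; yes; no)
open import Relation.Unary using (Decidable)
open import Relation.Binary using (tri<; tri≈; tri>)
open import Relation.Binary.PropositionalEquality using (_≡_; _≢_; refl; sym; trans; cong; cong₂; subst; subst₂)
open import Relation.Binary.PropositionalEquality using (module ≡-Reasoning)

open +-*-Solver

p≤p+q : ∀ p {q} → 0ℚ ≤ q → p ≤ p + q
p≤p+q p {q} 0≤q = subst (_≤ p + q) (+-identityʳ p) (+-monoʳ-≤ p 0≤q)

p≤q+p : ∀ p {q} → 0ℚ ≤ q → p ≤ q + p
p≤q+p p {q} 0≤q = subst (_≤ q + p) (+-identityˡ p) (+-monoˡ-≤ p 0≤q)

module _ {A : Set} where

  linked-∷ʳ : ∀ {R : A → A → Set} xs {x y} → Linked R (xs ∷ʳ x) → R x y → Linked R (xs ∷ʳ x ∷ʳ y)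
  linked-∷ʳ []           _          Rxy = Rxy ∷ [-]
  linked-∷ʳ (_ ∷ [])     (R₁ ∷ _)   Rxy = R₁ ∷ Rxy ∷ [-]
  linked-∷ʳ (_ ∷ z ∷ zs) (R₁ ∷ Rzs) Rxy = R₁ ∷ linked-∷ʳ (z ∷ zs) Rzs Rxy

  linked-restrict : ∀ {R S : A → A → Set} {P : A → Set} {xs} →
                    (∀ {x y} → P x → P y → R x y → S x y) → All P xs → Linked R xs → Linked S xs
  linked-restrict f _               []        = []
  linked-restrict f _               [-]       = [-]
  linked-restrict f (px ∷ py ∷ pxs) (r ∷ rs) = f px py r ∷ linked-restrict f (py ∷ pxs) rs

  ∈-∃↭ : ∀ {x : A} {xs} → x ∈ₗ xs → ∃ λ ys → xs ↭ x ∷ ys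
  ∈-∃↭ {x} x∈xs with ∈-∃++ x∈xs
  ... | ys , zs , refl = ys ++ zs , shift x ys zs

  unique-rotate : ∀ {x : A} xs → Unique (x ∷ xs) → Unique (xs ∷ʳ x)
  unique-rotate []       _                            = [] ∷ []
  unique-rotate (y ∷ ys) ((x≢y ∷ x∉ys) ∷ y∉ys ∷ uniq) =
    All.++⁺ y∉ys ((λ y≡x → x≢y (sym y≡x)) ∷ []) ∷ unique-rotate ys (x∉ys ∷ uniq)

module _ {n : ℕ} where

  open DecMembership (_≟_ {n}) using () renaming (_∈?_ to _∈ₗ?_)

  Adj-sym : ∀ {F : List (Edge n)} {u v} → Adj F u v → Adj F v u
  Adj-sym (inj₁ p) = inj₂ p
  Adj-sym (inj₂ p) = inj₁ p

  Adj-mono : ∀ {F G : List (Edge n)} → (∀ {e} → e ∈ₗ F → e ∈ₗ G) → ∀ {u v} → Adj F u v → Adj G u v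
  Adj-mono F⊆G (inj₁ p) = inj₁ (F⊆G p)
  Adj-mono F⊆G (inj₂ p) = inj₂ (F⊆G p)

  Adj-∷⁻ : ∀ {e} {F : List (Edge n)} {u v} → Adj (e ∷ F) u v → Adj [ e ] u v ⊎ Adj F u v
  Adj-∷⁻ (inj₁ (here p))  = inj₁ (inj₁ (here p))
  Adj-∷⁻ (inj₁ (there p)) = inj₂ (inj₁ p)
  Adj-∷⁻ (inj₂ (here p))  = inj₁ (inj₂ (here p))
  Adj-∷⁻ (inj₂ (there p)) = inj₂ (inj₂ p)

  Adj-[]-ends : ∀ {e : Edge n} {u v x y} → Adj [ e ] u v → Adj [ e ] x y →
                (x ≡ u × y ≡ v) ⊎ (x ≡ v × y ≡ u)
  Adj-[]-ends (inj₁ (here refl)) (inj₁ (here refl)) = inj₁ (refl , refl)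
  Adj-[]-ends (inj₁ (here refl)) (inj₂ (here refl)) = inj₂ (refl , refl)
  Adj-[]-ends (inj₂ (here refl)) (inj₁ (here refl)) = inj₂ (refl , refl)
  Adj-[]-ends (inj₂ (here refl)) (inj₂ (here refl)) = inj₁ (refl , refl)

  joins-ends : ∀ {P : Fin n → Set} {e u v} → Adj [ e ] u v → P u → P v → P (proj₁ e) × P (proj₂ e)
  joins-ends (inj₁ (here refl)) pu pv = pu , pv
  joins-ends (inj₂ (here refl)) pu pv = pv , pu

  Incident : Fin n → Edge n → Set
  Incident v e = ∃ λ w → Adj [ e ] v w

  incident? : ∀ v e → Dec (Incident v e)
  incident? v (x , y) with x ≟ v | y ≟ v
  ... | yes refl | _        = yes (y , inj₁ (here refl))
  ... | no _     | yes refl = yes (x , inj₂ (here refl))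
  ... | no x≢v   | no y≢v   = no λ { (_ , inj₁ (here refl)) → x≢v refl ; (_ , inj₂ (here refl)) → y≢v refl }

  walk-++ : ∀ {F : List (Edge n)} {u v w} → Walk F u v → Walk F v w → Walk F u w
  walk-++ here       q = q
  walk-++ (step a p) q = step a (walk-++ p q)

  walk-reverse : ∀ {F : List (Edge n)} {u v} → Walk F u v → Walk F v u
  walk-reverse here       = here
  walk-reverse (step a p) = walk-++ (walk-reverse p) (step (Adj-sym a) here)

  walk-mono : ∀ {F G : List (Edge n)} → (∀ {e} → e ∈ₗ F → e ∈ₗ G) → ∀ {u v} → Walk F u v → Walk G u v
  walk-mono F⊆G here       = here
  walk-mono F⊆G (step a p) = step (Adj-mono F⊆G a) (walk-mono F⊆G p)

  module _ {F : List (Edge n)} where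

    cycle-rotate₁ : ∀ x xs → Cycle F (x ∷ xs) → Cycle F (xs ∷ʳ x)
    cycle-rotate₁ x []       (s≤s () , _)
    cycle-rotate₁ x (y ∷ ys) (3≤ , uniq , Rxy ∷ linked) =
      subst (3 ≤ₙ_) (length-++-comm [ x ] (y ∷ ys)) 3≤
      , unique-rotate (y ∷ ys) uniq
      , linked-∷ʳ (y ∷ ys) linked Rxy

    cycle-rotate : ∀ xs ys → Cycle F (xs ++ ys) → Cycle F (ys ++ xs)
    cycle-rotate []       ys cyc = subst (Cycle F) (sym (++-identityʳ ys)) cyc
    cycle-rotate (x ∷ xs) ys cyc =
      subst (Cycle F) (++-assoc ys [ x ] xs)
        (cycle-rotate xs (ys ∷ʳ x) (subst (Cycle F) (++-assoc xs ys [ x ]) (cycle-rotate₁ x (xs ++ ys) cyc)))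

    cycle-neighbours-head : ∀ w ys → Cycle F (w ∷ ys) → ∃₂ λ a b → a ≢ b × Adj F a w × Adj F w b
    cycle-neighbours-head w ys cyc with initLast ys
    cycle-neighbours-head w .[] (s≤s () , _) | []
    cycle-neighbours-head w .(zs ∷ʳ a) cyc | zs ∷ʳ′ a = neighbours zs (cycle-rotate (w ∷ zs) [ a ] cyc)
      where
      neighbours : ∀ zs → Cycle F (a ∷ w ∷ zs) → ∃₂ λ a b → a ≢ b × Adj F a w × Adj F w b
      neighbours []       (s≤s (s≤s ()) , _)
      neighbours (b ∷ _) (_ , (_ ∷ a≢b ∷ _) ∷ _ , Raw ∷ Rwb ∷ _) = a , b , a≢b , Raw , Rwb

    cycle-neighbours : ∀ {vs w} → Cycle F vs → w ∈ₗ vs → ∃₂ λ a b → a ≢ b × Adj F a w × Adj F w b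
    cycle-neighbours {w = w} cyc w∈vs with ∈-∃++ w∈vs
    ... | xs , ys , refl = cycle-neighbours-head w (ys ++ xs) (cycle-rotate xs (w ∷ ys) cyc)

  acyclic-[] : Acyclic {n} []
  acyclic-[] (v ∷ _) cyc with cycle-neighbours cyc (here refl)
  ... | _ , _ , _ , inj₁ () , _
  ... | _ , _ , _ , inj₂ () , _

  acyclic-pendant : ∀ {F : List (Edge n)} {e v w} → v ≢ w → Adj [ e ] v w → (∀ {x} → ¬ Adj F x w) →
                    Acyclic F → Acyclic (e ∷ F)
  acyclic-pendant {F} {e} {v} {w} v≢w e-vw w-isolated acyclic vs cyc with w ∈ₗ? vs
  ... | yes w∈vs =
    let a , b , a≢b , Raw , Rwb = cycle-neighbours cyc w∈vs
    in a≢b (trans (only-neighbour Raw) (sym (only-neighbour (Adj-sym Rwb))))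
    where
    only-neighbour : ∀ {x} → Adj (e ∷ F) x w → x ≡ v
    only-neighbour xw with Adj-∷⁻ xw
    ... | inj₂ xw∈F = ⊥-elim (w-isolated xw∈F)
    ... | inj₁ xw∈e with Adj-[]-ends e-vw xw∈e
    ...   | inj₁ (x≡v , _)   = x≡v
    ...   | inj₂ (_ , w≡v)   = ⊥-elim (v≢w (sym w≡v))
  acyclic-pendant {F} {e} {v} {w} v≢w e-vw w-isolated acyclic (u ∷ us) (3≤ , uniq , linked) | no w∉vs =
    acyclic (u ∷ us) (3≤ , uniq , linked-restrict avoid-w (All.tabulate not-w) linked)
    where
    not-w : ∀ {x} → x ∈ₗ (u ∷ us) ∷ʳ u → x ≢ w
    not-w (here refl)  refl = w∉vs (here refl)
    not-w (there x∈) refl with ∈-++⁻ us x∈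
    ... | inj₁ x∈us       = w∉vs (there x∈us)
    ... | inj₂ (here refl) = w∉vs (here refl)
    avoid-w : ∀ {x y} → x ≢ w → y ≢ w → Adj (e ∷ F) x y → Adj F x y
    avoid-w x≢w y≢w xy with Adj-∷⁻ xy
    ... | inj₂ xy∈F = xy∈F
    ... | inj₁ xy∈e with Adj-[]-ends e-vw xy∈e
    ...   | inj₁ (_ , y≡w) = ⊥-elim (y≢w y≡w)
    ...   | inj₂ (x≡w , _) = ⊥-elim (x≢w x≡w)

  edge : Fin n → Fin n → Edge n
  edge u w with <-cmp u w
  ... | tri< _ _ _ = u , w
  ... | tri≈ _ _ _ = u , w
  ... | tri> _ _ _ = w , u

  edge-joins : ∀ u w → Adj [ edge u w ] u w
  edge-joins u w with <-cmp u w
  ... | tri< _ _ _ = inj₁ (here refl)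
  ... | tri≈ _ _ _ = inj₁ (here refl)
  ... | tri> _ _ _ = inj₂ (here refl)

  edge-canonical : ∀ {u w} → u ≢ w → toℕ (proj₁ (edge u w)) <ₙ toℕ (proj₂ (edge u w))
  edge-canonical {u} {w} u≢w with <-cmp u w
  ... | tri< u<w _ _ = u<w
  ... | tri≈ _ u≡w _ = ⊥-elim (u≢w u≡w)
  ... | tri> _ _ w<u = w<u

  Adj-inside : ∀ {U : Subset n} {F} → IsSpanningTree U F → ∀ {x y} → Adj F x y → x ∈ U × y ∈ U
  Adj-inside tree (inj₁ xy∈F) = IsSpanningTree.inside tree xy∈F
  Adj-inside tree (inj₂ yx∈F) = swap× (IsSpanningTree.inside tree yx∈F)

  spanningTree-[] : ∀ {U : Subset n} → (∀ {x y} → x ∈ U → y ∈ U → x ≡ y) → IsSpanningTree U []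
  spanningTree-[] subsingleton = record
    { canonical = λ ()
    ; inside    = λ ()
    ; distinct  = []
    ; connected = λ x y x∈U y∈U → subst (Walk [] x) (subsingleton x∈U y∈U) here
    ; acyclic   = acyclic-[]
    }

  spanningTree-resp-⊆⊇ : ∀ {U W : Subset n} {F} → IsSpanningTree U F → U ⊆ W → W ⊆ U → IsSpanningTree W F
  spanningTree-resp-⊆⊇ tree U⊆W W⊆U = record
    { canonical = canonical
    ; inside    = λ e∈F → map× U⊆W U⊆W (inside e∈F)
    ; distinct  = distinct
    ; connected = λ x y x∈W y∈W → connected x y (W⊆U x∈W) (W⊆U y∈W)
    ; acyclic   = acyclic
    }
    where open IsSpanningTree tree

  spanningTree-pendant : ∀ {U F v w} → IsSpanningTree U F → v ∈ U → w ∉ U →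
                         IsSpanningTree (⁅ w ⁆ ∪ U) (edge v w ∷ F)
  spanningTree-pendant {U} {F} {v} {w} tree v∈U w∉U = record
    { canonical = λ { (here refl) → edge-canonical v≢w ; (there e∈F) → canonical e∈F }
    ; inside    = λ { (here refl) → joins-ends {P = _∈ ⁅ w ⁆ ∪ U} (edge-joins v w)
                                                 (q⊆p∪q ⁅ w ⁆ U v∈U) (x∈p∪q⁺ (inj₁ (x∈⁅x⁆ w)))
                    ; (there e∈F) → map× (q⊆p∪q ⁅ w ⁆ U) (q⊆p∪q ⁅ w ⁆ U) (inside e∈F) }
    ; distinct  = All.tabulate edge∉F ∷ distinct
    ; connected = λ x y x∈ y∈ → walk-++ (walk-to-v x∈) (walk-reverse (walk-to-v y∈))
    ; acyclic   = acyclic-pendant v≢w (edge-joins v w) w-isolated acyclic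
    }
    where
    open IsSpanningTree tree
    v≢w : v ≢ w
    v≢w refl = w∉U v∈U
    w-isolated : ∀ {x} → ¬ Adj F x w
    w-isolated xw = w∉U (proj₂ (Adj-inside tree xw))
    edge∉F : ∀ {e} → e ∈ₗ F → edge v w ≢ e
    edge∉F e∈F refl = w-isolated (Adj-mono (λ { (here refl) → e∈F }) (edge-joins v w))
    walk-to-v : ∀ {x} → x ∈ ⁅ w ⁆ ∪ U → Walk (edge v w ∷ F) x v
    walk-to-v x∈ with x∈p∪q⁻ ⁅ w ⁆ U x∈
    ... | inj₁ x∈⁅w⁆ = subst (λ y → Walk _ y v) (sym (x∈⁅y⁆⇒x≡y w x∈⁅w⁆))
                         (step (Adj-mono (λ { (here refl) → here refl }) (Adj-sym (edge-joins v w))) here)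
    ... | inj₂ x∈U   = walk-mono there (connected _ v x∈U v∈U)

  -- join t₁ t₂ hangs t₂ from the root of t₁ by one edge; vertices may repeat.
  data RootedTree : Fin n → Set where
    leaf : ∀ v → RootedTree v
    join : ∀ {v s} → RootedTree v → RootedTree s → RootedTree v

  _∈ᵗ_ : ∀ {v} → Fin n → RootedTree v → Set
  x ∈ᵗ leaf v      = x ≡ v
  x ∈ᵗ join t₁ t₂ = x ∈ᵗ t₁ ⊎ x ∈ᵗ t₂

  root∈ᵗ : ∀ {v} (t : RootedTree v) → v ∈ᵗ t
  root∈ᵗ (leaf v)     = refl
  root∈ᵗ (join t₁ _) = inj₁ (root∈ᵗ t₁)

module _ {n : ℕ} (c : Fin n → Fin n → ℚ) where

  weight-↭ : ∀ {F G : List (Edge n)} → F ↭ G → weight c F ≡ weight c G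
  weight-↭ ↭.refl            = refl
  weight-↭ (↭.prep e F↭G)    = cong (_+_ (c (proj₁ e) (proj₂ e))) (weight-↭ F↭G)
  weight-↭ (↭.swap {ys = G} e f F↭G) =
    trans (cong (λ w → c (proj₁ e) (proj₂ e) + (c (proj₁ f) (proj₂ f) + w)) (weight-↭ F↭G))
          (solve 3 (λ a b w → a :+ (b :+ w) := b :+ (a :+ w))
                   refl (c (proj₁ e) (proj₂ e)) (c (proj₁ f) (proj₂ f)) (weight c G))
  weight-↭ (↭.trans F↭G G↭H) = trans (weight-↭ F↭G) (weight-↭ G↭H)

  cost : ∀ {v} → RootedTree v → ℚ
  cost (leaf _)              = 0ℚ
  cost (join {v} {s} t₁ t₂) = c v s + (cost t₁ + cost t₂)

module _ {n : ℕ} {c : Fin n → Fin n → ℚ} (metric : Metric c) where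
  open Metric metric

  weight-nonneg : ∀ F → 0ℚ ≤ weight c F
  weight-nonneg []      = ≤-refl
  weight-nonneg (_ ∷ F) = ≤-trans (nonneg _ _) (p≤p+q _ (weight-nonneg F))

  c-joins : ∀ {e : Edge n} {u v} → Adj [ e ] u v → c (proj₁ e) (proj₂ e) ≡ c u v
  c-joins (inj₁ (here refl)) = refl
  c-joins (inj₂ (here refl)) = symm _ _

  -- Growing a spanning tree along a rooted tree

  record Extension {v} (U : Subset n) (F : List (Edge n)) (t : RootedTree v) : Set where
    field
      U′             : Subset n
      F′             : List (Edge n)
      isSpanningTree : IsSpanningTree U′ F′
      U⊆U′           : U ⊆ U′
      t⊆U′           : ∀ {x} → x ∈ᵗ t → x ∈ U′
      U′⊆U∪t         : ∀ {x} → x ∈ U′ → x ∈ U ⊎ x ∈ᵗ t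
      weight-≤       : weight c F′ ≤ weight c F + cost c t

  extend-join : ∀ {U F v s} {t₁ : RootedTree v} {t₂ : RootedTree s} {U₂ F₂} (e₁ : Extension U F t₁) →
                Extension U₂ F₂ t₂ → Extension.U′ e₁ ⊆ U₂ → U₂ ⊆ ⁅ s ⁆ ∪ Extension.U′ e₁ →
                weight c F₂ ≤ c v s + weight c (Extension.F′ e₁) → Extension U F (join t₁ t₂)
  extend-join {U} {F} {v} {s} {t₁} {t₂} {F₂ = F₂} e₁ e₂ U₁⊆U₂ U₂⊆s∪U₁ F₂≤ = record
    { U′             = E₂.U′
    ; F′             = E₂.F′
    ; isSpanningTree = E₂.isSpanningTree
    ; U⊆U′           = λ x∈U → E₂.U⊆U′ (U₁⊆U₂ (E₁.U⊆U′ x∈U))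
    ; t⊆U′           = λ { (inj₁ x∈t₁) → E₂.U⊆U′ (U₁⊆U₂ (E₁.t⊆U′ x∈t₁))
                         ; (inj₂ x∈t₂) → E₂.t⊆U′ x∈t₂ }
    ; U′⊆U∪t         = U′⊆U∪t
    ; weight-≤       = weight-≤
    }
    where
    module E₁ = Extension e₁
    module E₂ = Extension e₂
    U′⊆U∪t : ∀ {x} → x ∈ E₂.U′ → x ∈ U ⊎ x ∈ᵗ join t₁ t₂
    U′⊆U∪t x∈U′ with E₂.U′⊆U∪t x∈U′
    ... | inj₂ x∈t₂ = inj₂ (inj₂ x∈t₂)
    ... | inj₁ x∈U₂ with x∈p∪q⁻ ⁅ s ⁆ E₁.U′ (U₂⊆s∪U₁ x∈U₂)
    ...   | inj₁ x∈⁅s⁆ = inj₂ (inj₂ (subst (_∈ᵗ t₂) (sym (x∈⁅y⁆⇒x≡y s x∈⁅s⁆)) (root∈ᵗ t₂)))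
    ...   | inj₂ x∈U₁ with E₁.U′⊆U∪t x∈U₁
    ...     | inj₁ x∈U  = inj₁ x∈U
    ...     | inj₂ x∈t₁ = inj₂ (inj₁ x∈t₁)
    weight-≤ : weight c E₂.F′ ≤ weight c F + cost c (join t₁ t₂)
    weight-≤ = begin
      weight c E₂.F′                          ≤⟨ E₂.weight-≤ ⟩
      weight c F₂ + cost c t₂                 ≤⟨ +-monoˡ-≤ (cost c t₂) F₂≤ ⟩
      (c v s + weight c E₁.F′) + cost c t₂    ≤⟨ +-monoˡ-≤ (cost c t₂) (+-monoʳ-≤ (c v s) E₁.weight-≤) ⟩
      (c v s + (weight c F + cost c t₁)) + cost c t₂
        ≡⟨ solve 4 (λ a f x y → (a :+ (f :+ x)) :+ y := f :+ (a :+ (x :+ y)))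
                   refl (c v s) (weight c F) (cost c t₁) (cost c t₂) ⟩
      weight c F + (c v s + (cost c t₁ + cost c t₂)) ∎
      where open ≤-Reasoning

  extend : ∀ {U F v} → IsSpanningTree U F → v ∈ U → (t : RootedTree v) → Extension U F t
  extend {U} {F} tree v∈U (leaf v) = record
    { U′             = U
    ; F′             = F
    ; isSpanningTree = tree
    ; U⊆U′           = ⊆-refl
    ; t⊆U′           = λ { refl → v∈U }
    ; U′⊆U∪t         = inj₁
    ; weight-≤       = ≤-reflexive (sym (+-identityʳ (weight c F)))
    }
  extend {U} {F} tree v∈U (join {v} {s} t₁ t₂) = attach (s ∈? E₁.U′)
    where
    e₁ = extend tree v∈U t₁
    module E₁ = Extension e₁
    attach : Dec (s ∈ E₁.U′) → Extension U F (join t₁ t₂)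
    attach (yes s∈U₁) =
      extend-join e₁ (extend E₁.isSpanningTree s∈U₁ t₂)
                  ⊆-refl (q⊆p∪q ⁅ s ⁆ E₁.U′) (p≤q+p _ (nonneg v s))
    attach (no s∉U₁) =
      extend-join e₁ (extend (spanningTree-pendant E₁.isSpanningTree (E₁.t⊆U′ (root∈ᵗ t₁)) s∉U₁)
                             (x∈p∪q⁺ (inj₁ (x∈⁅x⁆ s))) t₂)
                  (q⊆p∪q ⁅ s ⁆ E₁.U′) ⊆-refl
                  (≤-reflexive (cong (_+ weight c E₁.F′) (c-joins (edge-joins v s))))

  IsMST⇒weight≤cost : ∀ {U T r} → IsMST c U T → (t : RootedTree r) →
                      (∀ {x} → x ∈ᵗ t → x ∈ U) → (∀ {x} → x ∈ U → x ∈ᵗ t) → weight c T ≤ cost c t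
  IsMST⇒weight≤cost {U} {T} {r} mst t t⊆U U⊆t = begin
    weight c T     ≤⟨ IsMST.minimal mst E.F′ (spanningTree-resp-⊆⊇ E.isSpanningTree U′⊆U (E.t⊆U′ ∘ U⊆t)) ⟩
    weight c E.F′  ≤⟨ E.weight-≤ ⟩
    0ℚ + cost c t  ≡⟨ +-identityˡ (cost c t) ⟩
    cost c t       ∎
    where
    open ≤-Reasoning
    singleton : IsSpanningTree ⁅ r ⁆ []
    singleton = spanningTree-[] (λ x∈ y∈ → trans (x∈⁅y⁆⇒x≡y r x∈) (sym (x∈⁅y⁆⇒x≡y r y∈)))
    module E = Extension (extend singleton (x∈⁅x⁆ r) t)
    U′⊆U : E.U′ ⊆ U
    U′⊆U x∈U′ with E.U′⊆U∪t x∈U′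
    ... | inj₁ x∈⁅r⁆ = t⊆U (subst (_∈ᵗ t) (sym (x∈⁅y⁆⇒x≡y r x∈⁅r⁆)) (root∈ᵗ t))
    ... | inj₂ x∈t   = t⊆U x∈t

  -- Depth-first exploration

  record Exploration (v : Fin n) (E : List (Edge n)) : Set where
    field
      tree        : RootedTree v
      rest        : List (Edge n)
      cost-≤      : cost c tree + weight c rest ≤ weight c E
      rest⊆E      : ∀ {e} → e ∈ₗ rest → e ∈ₗ E
      E⊆rest∪tree : ∀ {e} → e ∈ₗ E → e ∈ₗ rest ⊎ (proj₁ e ∈ᵗ tree × proj₂ e ∈ᵗ tree)
      rest-avoids : ∀ {e} → e ∈ₗ rest → ¬ proj₁ e ∈ᵗ tree × ¬ proj₂ e ∈ᵗ tree
      length-≤    : length rest ≤ₙ length E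

  explore-leaf : ∀ {v E} → (∀ {e} → e ∈ₗ E → ¬ Incident v e) → Exploration v E
  explore-leaf {v} {E} isolated = record
    { tree        = leaf v
    ; rest        = E
    ; cost-≤      = ≤-reflexive (+-identityˡ (weight c E))
    ; rest⊆E      = λ e∈E → e∈E
    ; E⊆rest∪tree = inj₁
    ; rest-avoids = λ e∈E → (λ { refl → isolated e∈E (_ , inj₁ (here refl)) })
                          , (λ { refl → isolated e∈E (_ , inj₂ (here refl)) })
    ; length-≤    = ℕₚ.≤-refl
    }

  explore-join : ∀ {v w e E E₁} → Adj [ e ] v w → E ↭ e ∷ E₁ → (r₂ : Exploration w E₁) →
                 Exploration v (Exploration.rest r₂) → Exploration v E
  explore-join {v} {w} {e} {E} {E₁} e-vw E↭ r₂ r₁ = record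
    { tree        = join R₁.tree R₂.tree
    ; rest        = R₁.rest
    ; cost-≤      = cost-≤
    ; rest⊆E      = λ x∈ → ∈-resp-↭ (↭-sym E↭) (there (R₂.rest⊆E (R₁.rest⊆E x∈)))
    ; E⊆rest∪tree = E⊆rest∪tree
    ; rest-avoids = rest-avoids
    ; length-≤    = ℕₚ.≤-trans (ℕₚ.≤-trans R₁.length-≤ R₂.length-≤)
                               (subst (length E₁ ≤ₙ_) (sym (↭-length E↭)) (ℕₚ.n≤1+n _))
    }
    where
    module R₁ = Exploration r₁
    module R₂ = Exploration r₂
    cost-≤ : cost c (join R₁.tree R₂.tree) + weight c R₁.rest ≤ weight c E
    cost-≤ = begin
      (c v w + (cost c R₁.tree + cost c R₂.tree)) + weight c R₁.rest
        ≡⟨ solve 4 (λ a x y r → (a :+ (x :+ y)) :+ r := a :+ (y :+ (x :+ r)))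
                   refl (c v w) (cost c R₁.tree) (cost c R₂.tree) (weight c R₁.rest) ⟩
      c v w + (cost c R₂.tree + (cost c R₁.tree + weight c R₁.rest))
        ≤⟨ +-monoʳ-≤ (c v w) (+-monoʳ-≤ (cost c R₂.tree) R₁.cost-≤) ⟩
      c v w + (cost c R₂.tree + weight c R₂.rest)  ≤⟨ +-monoʳ-≤ (c v w) R₂.cost-≤ ⟩
      c v w + weight c E₁                          ≡⟨ cong (_+ weight c E₁) (sym (c-joins e-vw)) ⟩
      weight c (e ∷ E₁)                            ≡⟨ sym (weight-↭ c E↭) ⟩
      weight c E                                   ∎
      where open ≤-Reasoning
    t = join R₁.tree R₂.tree
    E⊆rest∪tree : ∀ {x} → x ∈ₗ E → x ∈ₗ R₁.rest ⊎ (proj₁ x ∈ᵗ t × proj₂ x ∈ᵗ t)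
    E⊆rest∪tree x∈E with ∈-resp-↭ E↭ x∈E
    ... | here refl = inj₂ (joins-ends {P = _∈ᵗ t} e-vw (inj₁ (root∈ᵗ R₁.tree)) (inj₂ (root∈ᵗ R₂.tree)))
    ... | there x∈E₁ with R₂.E⊆rest∪tree x∈E₁
    ...   | inj₂ (p , q) = inj₂ (inj₂ p , inj₂ q)
    ...   | inj₁ x∈rest₂ with R₁.E⊆rest∪tree x∈rest₂
    ...     | inj₁ x∈rest₁ = inj₁ x∈rest₁
    ...     | inj₂ (p , q) = inj₂ (inj₁ p , inj₁ q)
    rest-avoids : ∀ {x} → x ∈ₗ R₁.rest → ¬ proj₁ x ∈ᵗ t × ¬ proj₂ x ∈ᵗ t
    rest-avoids x∈ with R₁.rest-avoids x∈ | R₂.rest-avoids (R₁.rest⊆E x∈)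
    ... | p₁ , q₁ | p₂ , q₂ = [_,_] p₁ p₂ , [_,_] q₁ q₂

  explore : ∀ k v E → length E ≤ₙ k → Exploration v E
  explore zero    v []      _   = explore-leaf (λ ())
  explore (suc k) v E       len with any? (incident? v) E
  ... | no none = explore-leaf (λ e∈E inc → none (lose e∈E inc))
  ... | yes some with find some
  ...   | e , e∈E , w , e-vw with ∈-∃↭ e∈E
  ...     | E₁ , E↭ =
    let len₁ = ℕₚ.≤-pred (subst (_≤ₙ suc k) (↭-length E↭) len)
        r₂   = explore k w E₁ len₁
        r₁   = explore k v (Exploration.rest r₂) (ℕₚ.≤-trans (Exploration.length-≤ r₂) len₁)
    in explore-join e-vw E↭ r₂ r₁

  explore-closed : ∀ {v E} (r : Exploration v E) → ∀ {x y} → x ∈ᵗ Exploration.tree r → Walk E x y →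
                   y ∈ᵗ Exploration.tree r
  explore-closed r x∈t here = x∈t
  explore-closed r x∈t (step (inj₁ xz∈E) walk) with Exploration.E⊆rest∪tree r xz∈E
  ... | inj₁ xz∈rest  = ⊥-elim (proj₁ (Exploration.rest-avoids r xz∈rest) x∈t)
  ... | inj₂ (_ , z∈t) = explore-closed r z∈t walk
  explore-closed r x∈t (step (inj₂ zx∈E) walk) with Exploration.E⊆rest∪tree r zx∈E
  ... | inj₁ zx∈rest  = ⊥-elim (proj₂ (Exploration.rest-avoids r zx∈rest) x∈t)
  ... | inj₂ (z∈t , _) = explore-closed r z∈t walk

  connected⇒rootedTree : ∀ {T} → Connected ⊤ T → (r : Fin n) →
                         Σ (RootedTree r) λ t → (∀ x → x ∈ᵗ t) × cost c t ≤ weight c T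
  connected⇒rootedTree {T} connected r =
    R.tree , (λ x → explore-closed R (root∈ᵗ R.tree) (connected r x ∈⊤ ∈⊤))
           , ≤-trans (p≤p+q (cost c R.tree) (weight-nonneg R.rest)) R.cost-≤
    where
    R = explore (length T) r T ℕₚ.≤-refl
    module R = Exploration R

-- Charging

merge-bound : ∀ g m p S₁ S₂ x₁ x₂ {C₁ C₂} →
              g + (m + m) ≤ p + (x₁ + x₂) → S₁ + x₁ ≤ C₁ → S₂ + x₂ ≤ C₂ →
              (g + (S₁ + S₂)) + (m + m) ≤ p + (C₁ + C₂)
merge-bound g m p S₁ S₂ x₁ x₂ {C₁} {C₂} g≤ S₁≤ S₂≤ = begin
  (g + (S₁ + S₂)) + (m + m)
    ≡⟨ solve 4 (λ g m S₁ S₂ → (g :+ (S₁ :+ S₂)) :+ (m :+ m) := (g :+ (m :+ m)) :+ (S₁ :+ S₂))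
               refl g m S₁ S₂ ⟩
  (g + (m + m)) + (S₁ + S₂)
    ≤⟨ +-monoˡ-≤ (S₁ + S₂) g≤ ⟩
  (p + (x₁ + x₂)) + (S₁ + S₂)
    ≡⟨ solve 5 (λ p x₁ x₂ S₁ S₂ → (p :+ (x₁ :+ x₂)) :+ (S₁ :+ S₂) := p :+ ((S₁ :+ x₁) :+ (S₂ :+ x₂)))
               refl p x₁ x₂ S₁ S₂ ⟩
  p + ((S₁ + x₁) + (S₂ + x₂))
    ≤⟨ +-monoʳ-≤ p (+-mono-≤ S₁≤ S₂≤) ⟩
  p + (C₁ + C₂) ∎
  where open ≤-Reasoning

module _ {n : ℕ} {P : Fin n → Set} (P? : Decidable P) where

  charge : Fin n → ℚ → ℚ
  charge v a with P? v
  ... | yes _ = a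
  ... | no _  = a + a

  charge-nonneg : ∀ v {a} → 0ℚ ≤ a → 0ℚ ≤ charge v a
  charge-nonneg v 0≤a with P? v
  ... | yes _ = 0≤a
  ... | no _  = ≤-trans 0≤a (p≤p+q _ 0≤a)

  charge≤a+a : ∀ v {a} → 0ℚ ≤ a → charge v a ≤ a + a
  charge≤a+a v {a} 0≤a with P? v
  ... | yes _ = p≤p+q a 0≤a
  ... | no _  = ≤-refl

  charge-no : ∀ {v} → ¬ P v → ∀ a → charge v a ≡ a + a
  charge-no {v} ¬Pv a with P? v
  ... | yes Pv = ⊥-elim (¬Pv Pv)
  ... | no _   = refl

charge+charge-∁ : ∀ {n} (B : Subset n) v a → charge (_∈? B) v a + charge (_∈? ∁ B) v a ≡ a + (a + a)
charge+charge-∁ B v a with v ∈? B | v ∈? ∁ B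
... | yes v∈B | yes v∈∁B = ⊥-elim (x∈p⇒x∉∁p v∈B v∈∁B)
... | yes _   | no _     = refl
... | no _    | yes _    = solve 1 (λ a → (a :+ a) :+ a := a :+ (a :+ a)) refl a
... | no v∉B  | no v∉∁B  = ⊥-elim (v∉∁B (x∉p⇒x∈∁p v∉B))

module _ {n : ℕ} (c : Fin n → Fin n → ℚ) where

  chargedCost : ∀ {P : Fin n → Set} → Decidable P → ∀ {v} → RootedTree v → ℚ
  chargedCost P? (leaf _)              = 0ℚ
  chargedCost P? (join {v} {s} t₁ t₂) = charge P? v (c v s) + (chargedCost P? t₁ + chargedCost P? t₂)

  chargedCost+chargedCost-∁ : ∀ (B : Subset n) {v} (t : RootedTree v) →
                              chargedCost (_∈? B) t + chargedCost (_∈? ∁ B) t ≡ cost c t + (cost c t + cost c t)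
  chargedCost+chargedCost-∁ B (leaf _)              = refl
  chargedCost+chargedCost-∁ B (join {v} {s} t₁ t₂) = begin
    (charge (_∈? B) v (c v s) + (b₁ + b₂)) + (charge (_∈? ∁ B) v (c v s) + (r₁ + r₂))
      ≡⟨ solve 6 (λ p b₁ b₂ q r₁ r₂ →
                    (p :+ (b₁ :+ b₂)) :+ (q :+ (r₁ :+ r₂)) := (p :+ q) :+ ((b₁ :+ r₁) :+ (b₂ :+ r₂)))
                 refl (charge (_∈? B) v (c v s)) b₁ b₂ (charge (_∈? ∁ B) v (c v s)) r₁ r₂ ⟩
    (charge (_∈? B) v (c v s) + charge (_∈? ∁ B) v (c v s)) + ((b₁ + r₁) + (b₂ + r₂))
      ≡⟨ cong₂ _+_ (charge+charge-∁ B v (c v s))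
                   (cong₂ _+_ (chargedCost+chargedCost-∁ B t₁) (chargedCost+chargedCost-∁ B t₂)) ⟩
    (c v s + (c v s + c v s)) + ((x₁ + (x₁ + x₁)) + (x₂ + (x₂ + x₂)))
      ≡⟨ solve 3 (λ a x y → (a :+ (a :+ a)) :+ ((x :+ (x :+ x)) :+ (y :+ (y :+ y)))
                            := (a :+ (x :+ y)) :+ ((a :+ (x :+ y)) :+ (a :+ (x :+ y))))
                 refl (c v s) x₁ x₂ ⟩
    cost c (join t₁ t₂) + (cost c (join t₁ t₂) + cost c (join t₁ t₂)) ∎
    where
    open ≡-Reasoning
    b₁ = chargedCost (_∈? B) t₁
    b₂ = chargedCost (_∈? B) t₂
    r₁ = chargedCost (_∈? ∁ B) t₁
    r₂ = chargedCost (_∈? ∁ B) t₂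
    x₁ = cost c t₁
    x₂ = cost c t₂

module _ {n : ℕ} {c : Fin n → Fin n → ℚ} (metric : Metric c) where
  open Metric metric

  triangle′ : ∀ v x y → c x y ≤ c v x + c v y
  triangle′ v x y = subst (λ z → c x y ≤ z + c v y) (symm x v) (triangle x v y)

  slack-transfer : ∀ v s y {S C} → S + (c s y + c s y) ≤ C → S + (c v y + c v y) ≤ (c v s + c v s) + C
  slack-transfer v s y {S} {C} S≤C = begin
    S + (c v y + c v y)                      ≤⟨ +-monoʳ-≤ S (+-mono-≤ (triangle v s y) (triangle v s y)) ⟩
    S + ((c v s + c s y) + (c v s + c s y))
      ≡⟨ solve 3 (λ S d f → S :+ ((d :+ f) :+ (d :+ f)) := (d :+ d) :+ (S :+ (f :+ f))) refl S (c v s) (c s y) ⟩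
    (c v s + c v s) + (S + (c s y + c s y))  ≤⟨ +-monoʳ-≤ (c v s + c v s) S≤C ⟩
    (c v s + c v s) + C                      ∎
    where open ≤-Reasoning

  merge-slack : ∀ v s y₁ y₂ {m} → m ≤ c v y₁ → m ≤ c v y₂ →
                c y₁ y₂ + (m + m) ≤ (c v s + c v s) + ((c v y₁ + c v y₁) + (c s y₂ + c s y₂))
  merge-slack v s y₁ y₂ {m} m≤a m≤b = begin
    c y₁ y₂ + (m + m)              ≤⟨ +-mono-≤ (triangle′ v y₁ y₂) (+-mono-≤ m≤b m≤a) ⟩
    (a + b) + (b + a)              ≡⟨ solve 2 (λ a b → (a :+ b) :+ (b :+ a) := (a :+ a) :+ (b :+ b)) refl a b ⟩
    (a + a) + (b + b)              ≤⟨ +-monoʳ-≤ (a + a) (+-mono-≤ (triangle v s y₂) (triangle v s y₂)) ⟩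
    (a + a) + ((d + f) + (d + f))
      ≡⟨ solve 3 (λ a d f → (a :+ a) :+ ((d :+ f) :+ (d :+ f)) := (d :+ d) :+ ((a :+ a) :+ (f :+ f))) refl a d f ⟩
    (d + d) + ((a + a) + (f + f))  ∎
    where
    open ≤-Reasoning
    a = c v y₁
    b = c v y₂
    d = c v s
    f = c s y₂

  module _ {P : Fin n → Set} (P? : Decidable P) where

    chargedCost-nonneg : ∀ {v} (t : RootedTree v) → 0ℚ ≤ chargedCost c P? t
    chargedCost-nonneg (leaf _)              = ≤-refl
    chargedCost-nonneg (join {v} {s} t₁ t₂) =
      ≤-trans (charge-nonneg P? v (nonneg v s))
              (p≤p+q _ (≤-trans (chargedCost-nonneg t₁) (p≤p+q _ (chargedCost-nonneg t₂))))

    -- The slack 2·c(v, y) is what later pays for connecting y to the P-vertices outside t.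
    data Restriction {v} (t : RootedTree v) : Set where
      none : (∀ {x} → x ∈ᵗ t → ¬ P x) → Restriction t
      some : ∀ {y} (s : RootedTree y) → (∀ {x} → x ∈ᵗ s → P x) → (∀ {x} → x ∈ᵗ t → P x → x ∈ᵗ s) →
             (P v → y ≡ v) → cost c s + (c v y + c v y) ≤ chargedCost c P? t → Restriction t

    merge-slack-charged : ∀ {v s y₁ y₂} → (P v → y₁ ≡ v) → c v y₁ ≤ c v y₂ →
                          c y₁ y₂ + (c v y₁ + c v y₁) ≤ charge P? v (c v s) + ((c v y₁ + c v y₁) + (c s y₂ + c s y₂))
    merge-slack-charged {v} {s} {y₁} {y₂} root₁ a≤b with P? v
    ... | no _ = merge-slack v s y₁ y₂ ≤-refl a≤b
    ... | yes Pv with root₁ Pv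
    ...   | refl = begin
      c v y₂ + z             ≤⟨ +-monoˡ-≤ z (triangle v s y₂) ⟩
      (c v s + f) + z        ≤⟨ +-monoˡ-≤ z (+-monoʳ-≤ (c v s) (p≤p+q f (nonneg s y₂))) ⟩
      (c v s + (f + f)) + z  ≡⟨ solve 3 (λ d f z → (d :+ (f :+ f)) :+ z := d :+ (z :+ (f :+ f))) refl (c v s) f z ⟩
      c v s + (z + (f + f))  ∎
      where
      open ≤-Reasoning
      z = c v v + c v v
      f = c s y₂

    restrict-join : ∀ {v s} {t₁ : RootedTree v} {t₂ : RootedTree s} →
                    Restriction t₁ → Restriction t₂ → Restriction (join t₁ t₂)
    restrict-join (none ∉₁) (none ∉₂) = none ([_,_] ∉₁ ∉₂)
    restrict-join {v} {s} {t₂ = t₂} (some s₁ ⊆P₁ ⊇₁ root₁ bound₁) (none ∉₂) =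
      some s₁ ⊆P₁ (λ { (inj₁ x∈) Px → ⊇₁ x∈ Px ; (inj₂ x∈) Px → ⊥-elim (∉₂ x∈ Px) }) root₁
           (≤-trans bound₁
                    (≤-trans (p≤p+q _ (chargedCost-nonneg t₂)) (p≤q+p _ (charge-nonneg P? v (nonneg v s)))))
    restrict-join {v} {s} {t₁} {t₂} (none ∉₁) (some {y₂} s₂ ⊆P₂ ⊇₂ _ bound₂) =
      some s₂ ⊆P₂ (λ { (inj₁ x∈) Px → ⊥-elim (∉₁ x∈ Px) ; (inj₂ x∈) Px → ⊇₂ x∈ Px })
           (⊥-elim ∘ ¬Pv)
           (≤-trans (slack-transfer v s y₂ {cost c s₂} (≤-trans bound₂ (p≤q+p _ (chargedCost-nonneg t₁))))
                    (≤-reflexive (cong (_+ C) (sym (charge-no P? ¬Pv (c v s))))))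
      where
      ¬Pv = ∉₁ (root∈ᵗ t₁)
      C = chargedCost c P? t₁ + chargedCost c P? t₂
    restrict-join {v} {s} {t₁} {t₂} (some {y₁} s₁ ⊆P₁ ⊇₁ root₁ bound₁) (some {y₂} s₂ ⊆P₂ ⊇₂ _ bound₂)
      with c v y₁ ≤? c v y₂
    ... | yes a≤b =
      some (join s₁ s₂) ([_,_] ⊆P₁ ⊆P₂)
           (λ { (inj₁ x∈) Px → inj₁ (⊇₁ x∈ Px) ; (inj₂ x∈) Px → inj₂ (⊇₂ x∈ Px) })
           root₁
           (merge-bound (c y₁ y₂) (c v y₁) p (cost c s₁) (cost c s₂) (c v y₁ + c v y₁) (c s y₂ + c s y₂)
                        (merge-slack-charged root₁ a≤b) bound₁ bound₂)
      where p = charge P? v (c v s)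
    ... | no a≰b =
      some (join s₂ s₁) ([_,_] ⊆P₂ ⊆P₁)
           (λ { (inj₁ x∈) Px → inj₂ (⊇₁ x∈ Px) ; (inj₂ x∈) Px → inj₁ (⊇₂ x∈ Px) })
           (⊥-elim ∘ ¬Pv)
           (≤-trans (merge-bound (c y₂ y₁) (c v y₂) p (cost c s₂) (cost c s₁) (c s y₂ + c s y₂) (c v y₁ + c v y₁)
                                 slack bound₂ bound₁)
                    (≤-reflexive (cong (_+_ p) (+-comm (chargedCost c P? t₂) (chargedCost c P? t₁)))))
      where
      p = charge P? v (c v s)
      ¬Pv : ¬ P v
      ¬Pv Pv with root₁ Pv
      ... | refl = a≰b (subst (_≤ c v y₂) (sym (diag-zero v)) (nonneg v y₂))
      slack : c y₂ y₁ + (c v y₂ + c v y₂) ≤ p + ((c s y₂ + c s y₂) + (c v y₁ + c v y₁))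
      slack = subst₂ (λ g q → g + (c v y₂ + c v y₂) ≤ q + ((c s y₂ + c s y₂) + (c v y₁ + c v y₁)))
                     (symm y₁ y₂) (sym (charge-no P? ¬Pv (c v s)))
                     (subst (λ q → c y₁ y₂ + (c v y₂ + c v y₂) ≤ (c v s + c v s) + q)
                            (+-comm (c v y₁ + c v y₁) (c s y₂ + c s y₂))
                            (merge-slack v s y₁ y₂ (<⇒≤ (≰⇒> a≰b)) ≤-refl))

    restrict : ∀ {v} (t : RootedTree v) → Restriction t
    restrict (leaf v) with P? v
    ... | yes Pv = some (leaf v) (λ { refl → Pv }) (λ { refl _ → refl }) (λ _ → refl)
                        (≤-reflexive (cong (λ z → 0ℚ + (z + z)) (diag-zero v)))
    ... | no ¬Pv = none (λ { refl → ¬Pv })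
    restrict (join t₁ t₂) = restrict-join (restrict t₁) (restrict t₂)

  IsMST⇒weight≤chargedCost : ∀ {U T r} → IsMST c U T → (t : RootedTree r) → (∀ x → x ∈ᵗ t) →
                             weight c T ≤ chargedCost c (_∈? U) t
  IsMST⇒weight≤chargedCost {U} {T} {r} mst t covers with restrict (_∈? U) t
  ... | none ∉U = ≤-trans (IsMST.minimal mst [] (spanningTree-[] (λ x∈U _ → ⊥-elim (∉U (covers _) x∈U))))
                          (chargedCost-nonneg (_∈? U) t)
  ... | some {y} s s⊆U U⊆s _ bound = begin
    weight c T                  ≤⟨ IsMST⇒weight≤cost metric mst s s⊆U (λ x∈U → U⊆s (covers _) x∈U) ⟩
    cost c s                    ≤⟨ p≤p+q (cost c s) (≤-trans (nonneg r y) (p≤p+q _ (nonneg r y))) ⟩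
    cost c s + (c r y + c r y)  ≤⟨ bound ⟩
    chargedCost c (_∈? U) t     ∎
    where open ≤-Reasoning

  chargedCost≤cost+cost : ∀ {P : Fin n → Set} (P? : Decidable P) {v} (t : RootedTree v) →
                          chargedCost c P? t ≤ cost c t + cost c t
  chargedCost≤cost+cost P? (leaf _)              = ≤-refl
  chargedCost≤cost+cost P? (join {v} {s} t₁ t₂) =
    ≤-trans (+-mono-≤ (charge≤a+a P? v (nonneg v s))
                      (+-mono-≤ (chargedCost≤cost+cost P? t₁) (chargedCost≤cost+cost P? t₂)))
            (≤-reflexive (solve 3 (λ a x y → (a :+ a) :+ ((x :+ x) :+ (y :+ y)) := (a :+ (x :+ y)) :+ (a :+ (x :+ y)))
                                  refl (c v s) (cost c t₁) (cost c t₂)))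

lemma1 : (n : ℕ) (c : Fin n → Fin n → ℚ) → Metric c →
         (T : List (Edge n)) → IsMST c ⊤ T →
         (B : Subset n) (Tb Tr : List (Edge n)) →
         IsMST c B Tb → IsMST c (∁ B) Tr →
         ((weight c Tb + weight c Tr) ≤ ((+ 3 / 1) * weight c T))
         × ((weight c Tb ⊔ weight c Tr) ≤ ((+ 2 / 1) * weight c T))
lemma1 zero    _ _ ((() , _) ∷ _) _ _ _              _              _ _
lemma1 zero    _ _ []             _ _ ((() , _) ∷ _) _              _ _
lemma1 zero    _ _ []             _ _ []             ((() , _) ∷ _) _ _
lemma1 zero    _ _ []             _ _ []             []             _ _ = ≤-refl , ≤-refl
lemma1 (suc _) c metric T mst B Tb Tr mstB mstR
  with connected⇒rootedTree metric (IsSpanningTree.connected (IsMST.tree mst)) fzero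
... | t , covers , cost≤T = sum-bound , ⊔-lub (max-bound mstB) (max-bound mstR)
  where
  open ≤-Reasoning
  w = weight c T
  sum-bound : weight c Tb + weight c Tr ≤ (+ 3 / 1) * w
  sum-bound = begin
    weight c Tb + weight c Tr
      ≤⟨ +-mono-≤ (IsMST⇒weight≤chargedCost metric mstB t covers)
                  (IsMST⇒weight≤chargedCost metric mstR t covers) ⟩
    chargedCost c (_∈? B) t + chargedCost c (_∈? ∁ B) t
      ≡⟨ chargedCost+chargedCost-∁ c B t ⟩
    cost c t + (cost c t + cost c t)
      ≤⟨ +-mono-≤ cost≤T (+-mono-≤ cost≤T cost≤T) ⟩
    w + (w + w)
      ≡⟨ solve 1 (λ w → w :+ (w :+ w) := con (+ 3 / 1) :* w) refl w ⟩
    (+ 3 / 1) * w ∎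
  max-bound : ∀ {U Tu} → IsMST c U Tu → weight c Tu ≤ (+ 2 / 1) * w
  max-bound {U} {Tu} mstU = begin
    weight c Tu                    ≤⟨ IsMST⇒weight≤chargedCost metric mstU t covers ⟩
    chargedCost c (_∈? U) t   ≤⟨ chargedCost≤cost+cost metric (_∈? U) t ⟩
    cost c t + cost c t            ≤⟨ +-mono-≤ cost≤T cost≤T ⟩
    w + w                          ≡⟨ solve 1 (λ w → w :+ w := con (+ 2 / 1) :* w) refl w ⟩
    (+ 2 / 1) * w                  ∎
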